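{- Let $G=(V,E)$ be a finite sober connected graph with $\mathrm{c\text{ - }rk}\,G=3$. Then $\mathrm{Mat}\,G$ is a matroid.
   Context: Graphs are finite, undirected, without loops or multiple edges. $\mathrm{St}(v)$ is the set of neighbours of $v$; $G$ is sober if $v\mapsto\mathrm{St}(v)$ is injective. $\mathrm{c\text{ - }rk}\,G$ is the maximum number of independent columns of the $V\times V$ boolean matrix $A^c$ (entry $0$ if $\{i,j\}\in E$, else $1$), where vectors over the superboolean semiring $\{0,1,1^\nu\}$ (with $0+x=x$, $1+1=1^\nu$, $1^\nu+x=1^\nu$, $0\cdot x=0$, $1\cdot1=1$, $1\cdot1^\nu=1^\nu\cdot1^\nu=1^\nu$) are dependent if some $\{0,1\}$-combination with not all coefficients zero has all coordinates in $\{0,1^\nu\}$, and independent otherwise. $\mathrm{Mat}\,G$ is the collection consisting of all subsets of $V$ with at most 2 elements together with all 3-subsets $W\subseteq V$ such that $W\not\subseteq\mathrm{St}(v)$ for every $v\in V$. A matroid on $V$ is a nonempty collection of subsets of $V$ closed under taking subsets and satisfying: for all $I,J$ in it with $|I|=|J|+1$ there is $i\in I\setminus J$ with $J\cup\{i\}$ in it. -}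

module Defs where

open import Data.Nat using (ℕ; zero; suc; _≤_)
open import Data.Bool using (Bool; true; false; if_then_else_)
open import Data.Fin using (Fin; zero; suc)
open import Data.Fin.Subset using (Subset; _∈_; _⊆_; ∣_∣; _∪_; ⁅_⁆)
open import Data.Vec using (tabulate)
import Data.Vec
import Data.Fin.Subset
open import Data.Product using (Σ; ∃; _×_; _,_)
open import Data.Sum using (_⊎_)
open import Relation.Binary.PropositionalEquality using (_≡_)
open import Relation.Nullary using (¬_)

record Graph (n : ℕ) : Set where
  field
    adj   : Fin n → Fin n → Bool
    sym   : ∀ u v → adj u v ≡ adj v u
    irrefl : ∀ v → adj v v ≡ false
open Graph public

module _ {n : ℕ} (G : Graph n) where

  St : Fin n → Subset n
  St v = tabulate (adj G v)

  Sober : Set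
  Sober = ∀ u v → St u ≡ St v → u ≡ v

  data Reach : Fin n → Fin n → Set where
    here : ∀ {v} → Reach v v
    step : ∀ {u w v} → adj G u w ≡ true → Reach w v → Reach u v

  Connected : Set
  Connected = ∀ u v → Reach u v

data SB : Set where
  𝟘 𝟙 𝟙ν : SB

_⊕_ : SB → SB → SB
𝟘  ⊕ x = x
𝟙  ⊕ 𝟘 = 𝟙
𝟙  ⊕ 𝟙 = 𝟙ν
𝟙  ⊕ 𝟙ν = 𝟙ν
𝟙ν ⊕ x = 𝟙ν

_⊗_ : SB → SB → SB
𝟘  ⊗ x = 𝟘
𝟙  ⊗ 𝟘 = 𝟘
𝟙  ⊗ 𝟙 = 𝟙
𝟙  ⊗ 𝟙ν = 𝟙ν
𝟙ν ⊗ 𝟘 = 𝟘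
𝟙ν ⊗ 𝟙 = 𝟙ν
𝟙ν ⊗ 𝟙ν = 𝟙ν

∑ : ∀ {n} → (Fin n → SB) → SB
∑ {zero}  f = 𝟘
∑ {suc n} f = f zero ⊕ ∑ (λ i → f (suc i))

GhostOrZero : SB → Set
GhostOrZero x = (x ≡ 𝟘) ⊎ (x ≡ 𝟙ν)

bool→SB : Bool → SB
bool→SB true  = 𝟙
bool→SB false = 𝟘

module _ {n : ℕ} (G : Graph n) where

  Ac : Fin n → Fin n → SB
  Ac i j = if adj G i j then 𝟘 else 𝟙

  ColumnsDependent : Subset n → Set
  ColumnsDependent S =
    Σ (Fin n → Bool) λ c →
      (∃ λ j → j ∈ S × c j ≡ true) ×
      (∀ i → GhostOrZero (∑ (λ j → (if c j then (if Data.Vec.lookup S j then 𝟙 else 𝟘) else 𝟘) ⊗ Ac i j)))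

  ColumnsIndependent : Subset n → Set
  ColumnsIndependent S = ¬ ColumnsDependent S

  CRank≡ : ℕ → Set
  CRank≡ k = (∃ λ S → ColumnsIndependent S × ∣ S ∣ ≡ k)
           × (∀ S → ColumnsIndependent S → ∣ S ∣ ≤ k)

  Mat : Subset n → Set
  Mat W = (∣ W ∣ ≤ 2) ⊎ ((∣ W ∣ ≡ 3) × (∀ v → ¬ (W ⊆ St G v)))

IsMatroid : ∀ {n} → (Subset n → Set) → Set
IsMatroid {n} M =
  (∃ λ I → M I) ×
  (∀ I J → J ⊆ I → M I → M J) ×
  (∀ I J → M I → M J → ∣ I ∣ ≡ suc ∣ J ∣ →
     ∃ λ i → i ∈ I × ¬ (i ∈ J) × M (J ∪ ⁅ i ⁆))

module Submission where

-- Only two consequences of the hypotheses are used: every set of independent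
-- columns of A^c has at most 3 elements, and distinct vertices have distinct
-- neighbourhoods.
--
-- 1. Independence criterion: a set S of columns is independent as soon as
--    every nonzero {0,1}-combination of them has a "pivot row" w, in which
--    exactly one selected column has entry 1; that row sums to 1.
-- 2. Staircase lemma: four columns s₁..s₄ with rows w₁,w₂,w₃ such that
--    s_i ∉ St(w_i) and s_j ∈ St(w_i) for j > i are independent (s₄ itself
--    serves as fourth row); by c-rk G = 3 such a staircase cannot exist.
-- 3. Forcing lemma: for distinct a, b, p, q, if some vertex sees a, b, p but
--    not q, then every vertex seeing a and b also sees p.  Otherwise sobriety
--    yields a vertex separating a from b, which completes a staircase.
-- 4. Extension lemma: if J has two distinct elements, |J| < |I| and I lies in
--    no neighbourhood, some i ∈ I ∖ J has J ∪ {i} in no neighbourhood.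
--    Otherwise each such i has a neighbourhood containing J ∪ {i}; by forcing,
--    either that neighbourhood contains I or i lies in every neighbourhood
--    containing J, and in both cases I lies in a neighbourhood.
-- The matroid axioms then follow by cardinality bookkeeping; the exchange
-- axiom for |J| = 2, |I| = 3 is exactly the extension lemma.

open import Defs hiding (sym)
open import Data.Nat using (ℕ; zero; suc; _≤_; _<_; z≤n; _≤?_)
open import Data.Nat.Properties
  using (≤-trans; n≤1+n; ≤-reflexive; ≤-antisym; <⇒≱; ≰⇒>; suc-injective)
open import Data.Bool using (Bool; true; false; if_then_else_)
import Data.Bool as Bool
open import Data.Fin using (Fin; zero; suc)
open import Data.Fin.Properties using (any?) renaming (suc-injective to Fin-suc-injective)
open import Data.Fin.Subset
  using (Subset; _∈_; _∉_; _⊆_; ∣_∣; _∪_; _-_; ⁅_⁆; inside; outside; ⊥)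
open import Data.Fin.Subset.Properties
  using ( _∈?_; _⊆?_; ⊆-trans; p⊆q⇒∣p∣≤∣q∣; ∣⊥∣≡0; ∣⁅x⁆∣≡1; x∈⁅x⁆
        ; x∈⁅y⁆⇒x≡y; x∉⁅y⁆⇒x≢y; x≢y⇒x∉⁅y⁆; x∈p∪q⁻; x∈p∪q⁺; ∪-comm; ∪-identityʳ
        ; x∈p∧x≢y⇒x∈p-y; x∈p⇒∣p-x∣<∣p∣)
open import Data.Vec using (_∷_; lookup; here; there)
open import Data.Vec.Properties using ([]=⇒lookup; lookup⇒[]=; lookup∘tabulate; tabulate-cong)
open import Data.Product using (∃; ∃₂; _×_; _,_)
open import Data.Sum using (_⊎_; inj₁; inj₂)
open import Data.Empty using (⊥-elim)
open import Function using (_∘_)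
open import Relation.Nullary using (¬_; Dec; yes; no; contradiction)
open import Relation.Nullary.Decidable using (_×-dec_; ¬?; decidable-stable)
open import Relation.Binary.PropositionalEquality
  using (_≡_; _≢_; refl; sym; trans; cong; cong₂; subst; ≢-sym)

∈-∉⇒≢ : ∀ {n} {p : Subset n} {x y} → x ∈ p → y ∉ p → x ≢ y
∈-∉⇒≢ x∈p y∉p refl = y∉p x∈p

⊈-witness : ∀ {n} {p q : Subset n} → ¬ (p ⊆ q) → ∃ λ i → i ∈ p × i ∉ q
⊈-witness {p = p} {q} p⊈q with any? (λ i → i ∈? p ×-dec ¬? (i ∈? q))
... | yes found = found
... | no none = ⊥-elim (p⊈q λ {i} i∈p →
                  decidable-stable (i ∈? q) (λ i∉q → none (i , i∈p , i∉q)))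

card-witness : ∀ {n} {p q : Subset n} → ∣ q ∣ < ∣ p ∣ → ∃ λ i → i ∈ p × i ∉ q
card-witness q<p = ⊈-witness (<⇒≱ q<p ∘ p⊆q⇒∣p∣≤∣q∣)

two-members : ∀ {n} {p : Subset n} → 2 ≤ ∣ p ∣ → ∃₂ λ a b → a ∈ p × b ∈ p × a ≢ b
two-members {n} {p} 2≤p
  with card-witness {q = ⊥} (subst (_< ∣ p ∣) (sym (∣⊥∣≡0 n)) (≤-trans (n≤1+n 1) 2≤p))
... | a , a∈p , _
  with card-witness {q = ⁅ a ⁆} (subst (_< ∣ p ∣) (sym (∣⁅x⁆∣≡1 a)) 2≤p)
... | b , b∈p , b∉a = a , b , a∈p , b∈p , (λ a≡b → x∉⁅y⁆⇒x≢y b∉a (sym a≡b))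

⊆-card : ∀ {n} {p q : Subset n} → q ⊆ p → ∣ p ∣ ≤ ∣ q ∣ → p ⊆ q
⊆-card {p = p} {q} q⊆p p≤q {i} i∈p with i ∈? q
... | yes i∈q = i∈q
... | no i∉q = ⊥-elim (<⇒≱ (x∈p⇒∣p-x∣<∣p∣ i∈p) (≤-trans p≤q (p⊆q⇒∣p∣≤∣q∣ q⊆p-i)))
  where
  q⊆p-i : q ⊆ p - i
  q⊆p-i j∈q = x∈p∧x≢y⇒x∈p-y (q⊆p j∈q) (∈-∉⇒≢ j∈q i∉q)

card-insʳ : ∀ {n} (p : Subset n) {i} → i ∉ p → ∣ p ∪ ⁅ i ⁆ ∣ ≡ suc ∣ p ∣
card-insʳ (outside ∷ p) {zero}  _   = cong (suc ∘ ∣_∣) (∪-identityʳ p)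
card-insʳ (inside  ∷ p) {zero}  i∉p = contradiction here i∉p
card-insʳ (outside ∷ p) {suc i} i∉p = card-insʳ p (i∉p ∘ there)
card-insʳ (inside  ∷ p) {suc i} i∉p = cong suc (card-insʳ p (i∉p ∘ there))

card-insˡ : ∀ {n} (p : Subset n) {i} → i ∉ p → ∣ ⁅ i ⁆ ∪ p ∣ ≡ suc ∣ p ∣
card-insˡ p {i} i∉p = trans (cong ∣_∣ (∪-comm ⁅ i ⁆ p)) (card-insʳ p i∉p)

∉-insˡ : ∀ {n} {p : Subset n} {i x} → i ≢ x → i ∉ p → i ∉ ⁅ x ⁆ ∪ p
∉-insˡ {p = p} {x = x} i≢x i∉p i∈ with x∈p∪q⁻ ⁅ x ⁆ p i∈
... | inj₁ i∈x = i≢x (x∈⁅y⁆⇒x≡y x i∈x)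
... | inj₂ i∈p = i∉p i∈p

quartet : ∀ {n} → Fin n → Fin n → Fin n → Fin n → Subset n
quartet s₁ s₂ s₃ s₄ = ⁅ s₁ ⁆ ∪ ⁅ s₂ ⁆ ∪ ⁅ s₃ ⁆ ∪ ⁅ s₄ ⁆

quartet-elim : ∀ {n} {s₁ s₂ s₃ s₄ : Fin n} (P : Fin n → Set) →
  P s₁ → P s₂ → P s₃ → P s₄ → ∀ {j} → j ∈ quartet s₁ s₂ s₃ s₄ → P j
quartet-elim {s₁ = s₁} {s₂} {s₃} {s₄} P p₁ p₂ p₃ p₄ j∈ = case₁ j∈
  where
  at : ∀ {x j} → j ∈ ⁅ x ⁆ → P x → P j
  at {x} j∈x px = subst P (sym (x∈⁅y⁆⇒x≡y x j∈x)) px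
  case₃ : ∀ {j} → j ∈ ⁅ s₃ ⁆ ∪ ⁅ s₄ ⁆ → P j
  case₃ j∈ with x∈p∪q⁻ ⁅ s₃ ⁆ _ j∈
  ... | inj₁ j∈₃ = at j∈₃ p₃
  ... | inj₂ j∈₄ = at j∈₄ p₄
  case₂ : ∀ {j} → j ∈ ⁅ s₂ ⁆ ∪ ⁅ s₃ ⁆ ∪ ⁅ s₄ ⁆ → P j
  case₂ j∈ with x∈p∪q⁻ ⁅ s₂ ⁆ _ j∈
  ... | inj₁ j∈₂ = at j∈₂ p₂
  ... | inj₂ j∈′ = case₃ j∈′
  case₁ : ∀ {j} → j ∈ quartet s₁ s₂ s₃ s₄ → P j
  case₁ j∈ with x∈p∪q⁻ ⁅ s₁ ⁆ _ j∈
  ... | inj₁ j∈₁ = at j∈₁ p₁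
  ... | inj₂ j∈′ = case₂ j∈′

quartet-size : ∀ {n} {s₁ s₂ s₃ s₄ : Fin n} →
  s₁ ≢ s₂ → s₁ ≢ s₃ → s₁ ≢ s₄ → s₂ ≢ s₃ → s₂ ≢ s₄ → s₃ ≢ s₄ →
  ∣ quartet s₁ s₂ s₃ s₄ ∣ ≡ 4
quartet-size {s₄ = s₄} d₁₂ d₁₃ d₁₄ d₂₃ d₂₄ d₃₄ =
  trans (card-insˡ _ (∉-insˡ d₁₂ (∉-insˡ d₁₃ (x≢y⇒x∉⁅y⁆ d₁₄))))
 (cong suc (trans (card-insˡ _ (∉-insˡ d₂₃ (x≢y⇒x∉⁅y⁆ d₂₄)))
 (cong suc (trans (card-insˡ _ (x≢y⇒x∉⁅y⁆ d₃₄)) (cong suc (∣⁅x⁆∣≡1 s₄))))))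

∑-zero : ∀ {m} (f : Fin m → SB) → (∀ j → f j ≡ 𝟘) → ∑ f ≡ 𝟘
∑-zero {zero}  f _     = refl
∑-zero {suc m} f zeros = cong₂ _⊕_ (zeros zero) (∑-zero (f ∘ suc) (zeros ∘ suc))

∑-single : ∀ {m} (f : Fin m → SB) (k : Fin m) → f k ≡ 𝟙 → (∀ j → j ≢ k → f j ≡ 𝟘) → ∑ f ≡ 𝟙
∑-single f zero fk others =
  cong₂ _⊕_ fk (∑-zero (f ∘ suc) (λ j → others (suc j) λ ()))
∑-single f (suc k) fk others =
  trans (cong (_⊕ ∑ (f ∘ suc)) (others zero λ ()))
        (∑-single (f ∘ suc) k fk (λ j j≢k → others (suc j) (j≢k ∘ Fin-suc-injective)))

𝟙-not-ghost : ¬ GhostOrZero 𝟙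
𝟙-not-ghost (inj₁ ())
𝟙-not-ghost (inj₂ ())

module Columns {n : ℕ} (G : Graph n) where

  ∈St⇒adj : ∀ {w x} → x ∈ St G w → adj G w x ≡ true
  ∈St⇒adj {w} {x} x∈ = trans (sym (lookup∘tabulate (adj G w) x)) ([]=⇒lookup x∈)

  adj⇒∈St : ∀ {w x} → adj G w x ≡ true → x ∈ St G w
  adj⇒∈St {w} {x} e = lookup⇒[]= x (St G w) (trans (lookup∘tabulate (adj G w) x) e)

  ∉St⇒nonadj : ∀ {w x} → x ∉ St G w → adj G w x ≡ false
  ∉St⇒nonadj {w} {x} x∉ with adj G w x in e
  ... | true  = contradiction (adj⇒∈St e) x∉
  ... | false = refl

  -- No vertex is its own neighbour, so every column has entry 1 in its own row.
  loopless : ∀ x → x ∉ St G x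
  loopless x x∈ with trans (sym (∈St⇒adj x∈)) (irrefl G x)
  ... | ()

  PivotRow : (Fin n → Bool) → Subset n → Set
  PivotRow c S = ∃₂ λ w k → k ∈ S × c k ≡ true × k ∉ St G w ×
                   (∀ {j} → j ∈ S → c j ≡ true → j ≢ k → j ∈ St G w)

  -- Columns are independent if every nonzero combination has a pivot row,
  -- because the pivot row of the combination sums to 1.
  independent-by-pivots : ∀ S → (∀ c → (∃ λ j → j ∈ S × c j ≡ true) → PivotRow c S) →
                          ColumnsIndependent G S
  independent-by-pivots S pivot (c , support , ghost)
    with pivot c support
  ... | w , k , k∈S , ck , k∉w , others =
    𝟙-not-ghost (subst GhostOrZero (∑-single term k pivot-term other-term) (ghost w))
    where
    term : Fin n → SB
    term j = (if c j then (if lookup S j then 𝟙 else 𝟘) else 𝟘) ⊗ Ac G w j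
    pivot-term : term k ≡ 𝟙
    pivot-term rewrite ck | []=⇒lookup k∈S | ∉St⇒nonadj k∉w = refl
    other-term : ∀ j → j ≢ k → term j ≡ 𝟘
    other-term j j≢k with c j in cj | lookup S j in Sj
    ... | false | _     = refl
    ... | true  | false = refl
    ... | true  | true rewrite ∈St⇒adj (others (lookup⇒[]= j S Sj) cj j≢k) = refl

  -- Staircase lemma: four columns with a triangular pattern of rows are
  -- independent; the pivot of a combination is its first selected column.
  staircase-independent : ∀ {s₁ s₂ s₃ s₄ w₁ w₂ w₃} →
    s₁ ∉ St G w₁ → s₂ ∈ St G w₁ → s₃ ∈ St G w₁ → s₄ ∈ St G w₁ →
                   s₂ ∉ St G w₂ → s₃ ∈ St G w₂ → s₄ ∈ St G w₂ →
                                  s₃ ∉ St G w₃ → s₄ ∈ St G w₃ →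
    ColumnsIndependent G (quartet s₁ s₂ s₃ s₄)
  staircase-independent {s₁} {s₂} {s₃} {s₄} {w₁} {w₂} {w₃}
                        n₁₁ a₁₂ a₁₃ a₁₄ n₂₂ a₂₃ a₂₄ n₃₃ a₃₄ =
    independent-by-pivots S pivot
    where
    S : Subset n
    S = quartet s₁ s₂ s₃ s₄
    in₁ : s₁ ∈ S
    in₁ = x∈p∪q⁺ (inj₁ (x∈⁅x⁆ s₁))
    in₂ : s₂ ∈ S
    in₂ = x∈p∪q⁺ (inj₂ (x∈p∪q⁺ (inj₁ (x∈⁅x⁆ s₂))))
    in₃ : s₃ ∈ S
    in₃ = x∈p∪q⁺ (inj₂ (x∈p∪q⁺ (inj₂ (x∈p∪q⁺ (inj₁ (x∈⁅x⁆ s₃))))))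
    in₄ : s₄ ∈ S
    in₄ = x∈p∪q⁺ (inj₂ (x∈p∪q⁺ (inj₂ (x∈p∪q⁺ (inj₂ (x∈⁅x⁆ s₄))))))
    clash : ∀ {b : Bool} {A : Set} → b ≡ false → b ≡ true → A
    clash refl ()
    pivot : ∀ c → (∃ λ j → j ∈ S × c j ≡ true) → PivotRow c S
    pivot c (j , j∈S , cj) with c s₁ in c₁ | c s₂ in c₂ | c s₃ in c₃ | c s₄ in c₄
    ... | true | _ | _ | _ = w₁ , s₁ , in₁ , c₁ , n₁₁ ,
      quartet-elim (λ j → c j ≡ true → j ≢ s₁ → j ∈ St G w₁)
        (λ _ ne → contradiction refl ne) (λ _ _ → a₁₂) (λ _ _ → a₁₃) (λ _ _ → a₁₄)
    ... | false | true | _ | _ = w₂ , s₂ , in₂ , c₂ , n₂₂ ,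
      quartet-elim (λ j → c j ≡ true → j ≢ s₂ → j ∈ St G w₂)
        (clash c₁) (λ _ ne → contradiction refl ne) (λ _ _ → a₂₃) (λ _ _ → a₂₄)
    ... | false | false | true | _ = w₃ , s₃ , in₃ , c₃ , n₃₃ ,
      quartet-elim (λ j → c j ≡ true → j ≢ s₃ → j ∈ St G w₃)
        (clash c₁) (clash c₂) (λ _ ne → contradiction refl ne) (λ _ _ → a₃₄)
    ... | false | false | false | true = s₄ , s₄ , in₄ , c₄ , loopless s₄ ,
      quartet-elim (λ j → c j ≡ true → j ≢ s₄ → j ∈ St G s₄)
        (clash c₁) (clash c₂) (clash c₃) (λ _ ne → contradiction refl ne)
    ... | false | false | false | false =
      quartet-elim (λ j → c j ≡ true → PivotRow c S)
        (clash c₁) (clash c₂) (clash c₃) (clash c₄) j∈S cj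

  separating : Sober G → ∀ {a b} → a ≢ b →
    ∃ λ w → (b ∈ St G w × a ∉ St G w) ⊎ (a ∈ St G w × b ∉ St G w)
  separating sober {a} {b} a≢b with any? (λ w → ¬? (adj G w a Bool.≟ adj G w b))
  ... | no none = ⊥-elim (a≢b (sober a b (tabulate-cong same)))
    where
    same : ∀ w → adj G a w ≡ adj G b w
    same w = trans (Graph.sym G a w)
               (trans (decidable-stable (adj G w a Bool.≟ adj G w b) (λ ne → none (w , ne)))
                      (Graph.sym G w b))
  ... | yes (w , differ) with adj G w a in wa | adj G w b in wb
  ... | true  | true  = contradiction refl differ
  ... | false | false = contradiction refl differ
  ... | true  | false = w , inj₂ (adj⇒∈St wa , λ b∈ → contradiction (trans (sym wb) (∈St⇒adj b∈)) λ ())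
  ... | false | true  = w , inj₁ (adj⇒∈St wb , λ a∈ → contradiction (trans (sym wa) (∈St⇒adj a∈)) λ ())

  Star : Subset n → Set
  Star T = ∃ λ v → T ⊆ St G v

  star? : ∀ T → Dec (Star T)
  star? T = any? (λ v → T ⊆? St G v)

module Rank3 {n : ℕ} (G : Graph n) (sober : Sober G)
             (rank≤3 : ∀ S → ColumnsIndependent G S → ∣ S ∣ ≤ 3) where

  open Columns G

  no-staircase : ∀ {s₁ s₂ s₃ s₄ w₁ w₂ w₃} →
    s₁ ≢ s₂ → s₁ ≢ s₃ → s₁ ≢ s₄ → s₂ ≢ s₃ → s₂ ≢ s₄ → s₃ ≢ s₄ →
    s₁ ∉ St G w₁ → s₂ ∈ St G w₁ → s₃ ∈ St G w₁ → s₄ ∈ St G w₁ →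
                   s₂ ∉ St G w₂ → s₃ ∈ St G w₂ → s₄ ∈ St G w₂ →
                                  s₃ ∉ St G w₃ → s₄ ∈ St G w₃ → ∀ {A : Set} → A
  no-staircase d₁₂ d₁₃ d₁₄ d₂₃ d₂₄ d₃₄ n₁₁ a₁₂ a₁₃ a₁₄ n₂₂ a₂₃ a₂₄ n₃₃ a₃₄ =
    ⊥-elim (<⇒≱ (≤-reflexive (sym (quartet-size d₁₂ d₁₃ d₁₄ d₂₃ d₂₄ d₃₄)))
      (rank≤3 _ (staircase-independent n₁₁ a₁₂ a₁₃ a₁₄ n₂₂ a₂₃ a₂₄ n₃₃ a₃₄)))

  -- Forcing lemma: if w₁ sees a, b, p but not q, every w₂ seeing a, b sees p.
  -- Otherwise q, p and the two of a, b separated by some w form a staircase.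
  forcing : ∀ {a b p q w₁ w₂} →
    a ≢ b → p ≢ q → p ≢ a → p ≢ b → q ≢ a → q ≢ b →
    a ∈ St G w₁ → b ∈ St G w₁ → p ∈ St G w₁ → q ∉ St G w₁ →
    a ∈ St G w₂ → b ∈ St G w₂ → p ∈ St G w₂
  forcing {a} {b} {p} {q} {w₁} {w₂} a≢b p≢q p≢a p≢b q≢a q≢b a₁ b₁ p₁ q₁ a₂ b₂
    with p ∈? St G w₂
  ... | yes p₂ = p₂
  ... | no p₂ with separating sober a≢b
  ... | w , inj₁ (b∈w , a∉w) =
    no-staircase (≢-sym p≢q) q≢a q≢b p≢a p≢b a≢b q₁ p₁ a₁ b₁ p₂ a₂ b₂ a∉w b∈w
  ... | w , inj₂ (a∈w , b∉w) =
    no-staircase (≢-sym p≢q) q≢b q≢a p≢b p≢a (≢-sym a≢b) q₁ p₁ b₁ a₁ p₂ b₂ a₂ b∉w a∈w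

  -- Merging stars: let a, b be distinct elements of J and t₀ ∈ I ∖ J.  If
  -- every t ∈ I ∖ J extends J to a star, then I is a star.  Each such t lies
  -- in a neighbourhood v ⊇ J ∪ {t}; if v misses some q ∈ I, forcing puts t in
  -- every neighbourhood containing a and b, in particular in that of t₀.
  stars-merge : ∀ {I J a b t₀} → a ∈ J → b ∈ J → a ≢ b → t₀ ∈ I → t₀ ∉ J →
                (∀ {t} → t ∈ I → t ∉ J → Star (J ∪ ⁅ t ⁆)) → Star I
  stars-merge {I} {J} {a} {b} a∈J b∈J a≢b t₀∈I t₀∉J extended-star
    with star? I | extended-star t₀∈I t₀∉J
  ... | yes starI | _ = starI
  ... | no nsI | v₀ , J+t₀⊆v₀ = ⊥-elim (nsI (v₀ , I⊆v₀))
    where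
    forced : ∀ {t} → t ∈ I → t ∉ J → ∀ {w} → a ∈ St G w → b ∈ St G w → t ∈ St G w
    forced {t} t∈I t∉J with extended-star t∈I t∉J
    ... | v , J+t⊆v with ⊈-witness (λ I⊆v → nsI (v , I⊆v))
    ... | q , _ , q∉v =
      forcing a≢b (∈-∉⇒≢ t∈v q∉v) (≢-sym (∈-∉⇒≢ a∈J t∉J)) (≢-sym (∈-∉⇒≢ b∈J t∉J))
              (≢-sym (∈-∉⇒≢ a∈v q∉v)) (≢-sym (∈-∉⇒≢ b∈v q∉v)) a∈v b∈v t∈v q∉v
      where
      a∈v : a ∈ St G v
      a∈v = J+t⊆v (x∈p∪q⁺ (inj₁ a∈J))
      b∈v : b ∈ St G v
      b∈v = J+t⊆v (x∈p∪q⁺ (inj₁ b∈J))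
      t∈v : t ∈ St G v
      t∈v = J+t⊆v (x∈p∪q⁺ (inj₂ (x∈⁅x⁆ t)))

    I⊆v₀ : I ⊆ St G v₀
    I⊆v₀ {i} i∈I with i ∈? J
    ... | yes i∈J = J+t₀⊆v₀ (x∈p∪q⁺ (inj₁ i∈J))
    ... | no i∉J = forced i∈I i∉J (J+t₀⊆v₀ (x∈p∪q⁺ (inj₁ a∈J))) (J+t₀⊆v₀ (x∈p∪q⁺ (inj₁ b∈J)))

  extension : ∀ I J → 2 ≤ ∣ J ∣ → ∣ J ∣ < ∣ I ∣ → ¬ Star I →
              ∃ λ i → i ∈ I × i ∉ J × ¬ Star (J ∪ ⁅ i ⁆)
  extension I J 2≤J J<I nsI
    with any? (λ i → i ∈? I ×-dec ¬? (i ∈? J) ×-dec ¬? (star? (J ∪ ⁅ i ⁆)))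
  ... | yes found = found
  ... | no none with two-members 2≤J | card-witness J<I
  ... | a , b , a∈J , b∈J , a≢b | t₀ , t₀∈I , t₀∉J =
    ⊥-elim (nsI (stars-merge a∈J b∈J a≢b t₀∈I t₀∉J extended-star))
    where
    extended-star : ∀ {t} → t ∈ I → t ∉ J → Star (J ∪ ⁅ t ⁆)
    extended-star t∈I t∉J = decidable-stable (star? _) (λ ns → none (_ , t∈I , t∉J , ns))

  Mat-∅ : Mat G ⊥
  Mat-∅ = inj₁ (subst (_≤ 2) (sym (∣⊥∣≡0 n)) z≤n)

  -- Mat G is closed under subsets: a subset of a non-star 3-set either has
  -- at most 2 elements or is the whole set.
  Mat-hereditary : ∀ I J → J ⊆ I → Mat G I → Mat G J
  Mat-hereditary I J J⊆I (inj₁ I≤2) = inj₁ (≤-trans (p⊆q⇒∣p∣≤∣q∣ J⊆I) I≤2)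
  Mat-hereditary I J J⊆I (inj₂ (I≡3 , nsI)) with ∣ J ∣ ≤? 2
  ... | yes J≤2 = inj₁ J≤2
  ... | no J≰2 = inj₂ (J≡3 , λ v J⊆v → nsI v (⊆-trans I⊆J J⊆v))
    where
    J≡3 : ∣ J ∣ ≡ 3
    J≡3 = ≤-antisym (subst (∣ J ∣ ≤_) I≡3 (p⊆q⇒∣p∣≤∣q∣ J⊆I)) (≰⇒> J≰2)
    I⊆J : I ⊆ J
    I⊆J = ⊆-card J⊆I (subst (_≤ ∣ J ∣) (sym I≡3) (≰⇒> J≰2))

  -- Exchange: for |I| ≤ 2 any i ∈ I ∖ J works; for |I| = 3 (so |J| = 2) the
  -- extension lemma supplies i.
  Mat-exchange : ∀ I J → Mat G I → Mat G J → ∣ I ∣ ≡ suc ∣ J ∣ →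
                 ∃ λ i → i ∈ I × i ∉ J × Mat G (J ∪ ⁅ i ⁆)
  Mat-exchange I J (inj₁ I≤2) _ I≡1+J with card-witness (≤-reflexive (sym I≡1+J))
  ... | i , i∈I , i∉J =
    i , i∈I , i∉J , inj₁ (subst (_≤ 2) (sym (trans (card-insʳ J i∉J) (sym I≡1+J))) I≤2)
  Mat-exchange I J (inj₂ (I≡3 , nsI)) _ I≡1+J =
    to-Mat (extension I J 2≤J (≤-reflexive (sym I≡1+J)) (λ (v , I⊆v) → nsI v I⊆v))
    where
    1+J≡3 : suc ∣ J ∣ ≡ 3
    1+J≡3 = trans (sym I≡1+J) I≡3
    2≤J : 2 ≤ ∣ J ∣
    2≤J = ≤-reflexive (sym (suc-injective 1+J≡3))
    to-Mat : (∃ λ i → i ∈ I × i ∉ J × ¬ Star (J ∪ ⁅ i ⁆)) →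
             ∃ λ i → i ∈ I × i ∉ J × Mat G (J ∪ ⁅ i ⁆)
    to-Mat (i , i∈I , i∉J , ns) =
      i , i∈I , i∉J , inj₂ (trans (card-insʳ J i∉J) 1+J≡3 , λ v J+i⊆v → ns (v , J+i⊆v))

proposition5p2 : (n : ℕ) (G : Graph n) → Sober G → Connected G → CRank≡ G 3 → IsMatroid (Mat G)
proposition5p2 n G sober _ (_ , rank≤3) =
  (⊥ , Mat-∅) , Mat-hereditary , Mat-exchange
  where open Rank3 G sober rank≤3
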